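{- Let $\mu,\nu\vdash n$, and let $k_0$ be the smallest nonnegative integer $k$ for which a transitive twisted factorisation of type $(k,\mu,\nu)$ exists. Then $k_0=\ell(\mu)+\ell(\nu)-2$.
   Context: Let $[\bar n]=\{1,\bar 1,\dots,n,\bar n\}$ with the total order $1<\bar 1<2<\bar 2<\cdots<n<\bar n$, $S_{2n}$ the symmetric group on $[\bar n]$, and $\tau=(1\ \bar1)\cdots(n\ \bar n)$. The type of a fixed-point-free involution $\rho\in S_{2n}$ is the partition $\lambda\vdash n$ such that the connected components of the graph on $[\bar n]$ with edges $\{x,\rho(x)\},\{x,\tau(x)\}$ have $2\lambda_1,\dots,2\lambda_\ell$ vertices; $d_\lambda$ is the set of fixed-point-free involutions of type $\lambda$; $S_{2n}$ acts by conjugation $\sigma.\rho=\sigma\rho\sigma^{ -1}$. For $k\ge0$ and $\mu,\nu\vdash n$, a twisted factorisation of type $(k,\mu,\nu)$ is a pair $(\rho,(\sigma_1,\dots,\sigma_k))$ with $\rho\in d_\nu$ and transpositions $\sigma_i=(p_i\ q_i)$, $q_i\in\{1,\dots,n\}$ (unbarred), $p_i\in[\bar n]$, $p_i<q_i$, such that $\sigma_k\cdots\sigma_1.\rho\in d_\mu$. It is transitive if the subgroup $\langle\tau,\rho,\sigma_1,\dots,\sigma_k\rangle\le S_{2n}$ acts transitively on $[\bar n]$. $\ell(\lambda)$ is the number of parts of $\lambda$. -}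

module Defs where

open import Data.Nat using (ℕ; zero; suc; _+_; _*_; _∸_; _≤_; _<_)
open import Data.Fin using (Fin; toℕ)
open import Data.Fin.Properties using () renaming (_≟_ to _≟F_)
open import Data.Bool using (Bool; true; false; not; if_then_else_)
import Data.Bool.Properties as BoolP
open import Data.Product using (Σ; _×_; _,_)
open import Data.Product.Properties using (≡-dec)
open import Data.List using (List; []; _∷_; length; map)
open import Data.Nat.ListAction using (sum)
open import Data.List.Membership.Propositional using (_∈_)
open import Data.List.Relation.Unary.All using (All)
open import Data.List.Relation.Unary.Any using (Any)
open import Data.List.Relation.Unary.Linked using (Linked)
open import Data.List.Relation.Unary.AllPairs using (AllPairs)
open import Data.List.Relation.Unary.Unique.Propositional using (Unique)
open import Data.List.Relation.Binary.Pointwise using (Pointwise)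
open import Data.List.Relation.Binary.Permutation.Propositional using (_↭_)
open import Relation.Binary.PropositionalEquality using (_≡_; _≢_)
open import Relation.Nullary using (¬_; yes; no; Dec)
open import Function.Bundles using (_⇔_)

-- The set [n̄] = {1, 1̄, …, n, n̄}: (i , false) encodes i+1, (i , true) encodes the barred (i+1).
Pt : ℕ → Set
Pt n = Fin n × Bool

-- position in the total order 1 < 1̄ < 2 < 2̄ < …
rank : ∀ {n} → Pt n → ℕ
rank (i , false) = 2 * toℕ i
rank (i , true)  = suc (2 * toℕ i)

_≟P_ : ∀ {n} (x y : Pt n) → Dec (x ≡ y)
_≟P_ = ≡-dec _≟F_ BoolP._≟_

τ : ∀ {n} → Pt n → Pt n
τ (i , b) = (i , not b)

-- ρ is a fixed-point-free involution of [n̄] (an involution is automatically a bijection)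
FPFInv : ∀ {n} → (Pt n → Pt n) → Set
FPFInv ρ = (∀ x → ρ (ρ x) ≡ x) × (∀ x → ρ x ≢ x)

-- y is in the orbit of x under the subgroup generated by the given permutations
-- (all generators used below are involutions, so closure under the generators is
-- closure under the generated subgroup)
data Orbit {n} (gens : List (Pt n → Pt n)) (x : Pt n) : Pt n → Set where
  here : Orbit gens x x
  step : ∀ {f y} → f ∈ gens → Orbit gens x y → Orbit gens x (f y)

-- connectivity in the graph with edges {x, ρ x}, {x, τ x}
Conn : ∀ {n} → (Pt n → Pt n) → Pt n → Pt n → Set
Conn ρ = Orbit (τ ∷ ρ ∷ [])

ComponentSize : ∀ {n} → (Pt n → Pt n) → Pt n → ℕ → Set
ComponentSize {n} ρ x c =
  Σ (List (Pt n)) λ L → Unique L × (∀ y → (y ∈ L) ⇔ Conn ρ x y) × length L ≡ c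

-- ρ ∈ d_λ : fixed-point-free involution whose components have sizes 2λ₁,…,2λ_ℓ
-- (R is a list of one representative per component)
HasType : ∀ {n} → (Pt n → Pt n) → List ℕ → Set
HasType {n} ρ λp =
  FPFInv ρ ×
  Σ (List (Pt n)) λ R → Σ (List ℕ) λ sizes →
    (∀ x → Any (λ r → Conn ρ r x) R) ×
    AllPairs (λ r s → ¬ Conn ρ r s) R ×
    Pointwise (λ r c → ComponentSize ρ r (2 * c)) R sizes ×
    sizes ↭ λp

IsPartition : ℕ → List ℕ → Set
IsPartition n λp = All (λ a → 1 ≤ a) λp × Linked (λ a b → b ≤ a) λp × sum λp ≡ n

record Transp (n : ℕ) : Set where
  field
    p   : Pt n
    q   : Fin n
    p<q : rank p < rank {n} (q , false)

swap : ∀ {n} → Pt n → Pt n → Pt n → Pt n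
swap a b x with x ≟P a
... | yes _ = b
... | no _ with x ≟P b
...   | yes _ = a
...   | no _ = x

transpFun : ∀ {n} → Transp n → Pt n → Pt n
transpFun σ = swap (Transp.p σ) (Transp.q σ , false)

-- σ.ρ = σ ρ σ⁻¹ = σ ρ σ
conj : ∀ {n} → Transp n → (Pt n → Pt n) → Pt n → Pt n
conj σ ρ x = transpFun σ (ρ (transpFun σ x))

-- σ_k ⋯ σ_1 . ρ for the list (σ_1 , … , σ_k)
act : ∀ {n} → List (Transp n) → (Pt n → Pt n) → Pt n → Pt n
act [] ρ = ρ
act (σ ∷ σs) ρ = act σs (conj σ ρ)

TransTwistedFact : (n k : ℕ) → List ℕ → List ℕ → Set
TransTwistedFact n k μ ν =
  Σ (Pt n → Pt n) λ ρ → Σ (List (Transp n)) λ σs →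
    length σs ≡ k ×
    HasType ρ ν ×
    HasType (act σs ρ) μ ×
    (∀ x y → Orbit (τ ∷ ρ ∷ map transpFun σs) x y)

IsLeast : (ℕ → Set) → ℕ → Set
IsLeast P k = P k × (∀ m → P m → k ≤ m)

{-# OPTIONS --safe #-}
-- Conjugating a fixed-point-free involution ρ by a transposition σ = (p q) only
-- changes the components through p and q. If p and q lie in one component of σ.ρ, then ρ has
-- at most one component more than σ.ρ, and σ moves no point out of its ⟨τ, σ.ρ⟩-orbit.
-- Otherwise p and q lie in one component of ρ (a parity argument), so σ.ρ has at least one
-- component more than ρ, while removing σ from the generators splits at most one orbit in two.
-- Inducting over σ₁, …, σₖ gives ℓ(μ) + ℓ(ν) ≤ k + 2·(number of orbits of ⟨τ, ρ, σ₁, …, σₖ⟩),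
-- which is k + 2 for a transitive factorisation. Connectivity is never decided, so the induction
-- runs in the double-negation monad; the resulting inequality of naturals is decidable, hence stable.
--
-- Let ρ_λ pair every barred point with the next unbarred one, cyclically within
-- consecutive blocks of sizes λ₁, λ₂, …. Conjugating by (1 λ₁+1) merges the first two blocks, so
-- ℓ(ν) − 1 transpositions carry ρ_ν to the one-block involution ρ_(n), and ℓ(μ) − 1 more, applied
-- in reverse order, carry ρ_(n) to ρ_μ. The factorisation is transitive because ρ_(n) is connected.
module Submission where

open import Defs
open import Algebra.Definitions using (Involutive)
open import Data.Bool using (Bool; true; false)
open import Data.Empty using (⊥; ⊥-elim)
open import Data.Fin using (toℕ; fromℕ<)
open import Data.Fin.Properties using (toℕ-fromℕ<; toℕ-injective; toℕ<n)
open import Data.List using (List; []; _∷_; length; map; _++_; reverse; filter; allFin; cartesianProduct)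
open import Data.List.Properties
  using (unfold-reverse; length-++; length-reverse; filter-all; filter-accept; filter-reject; map-∘)
open import Data.List.Membership.Propositional using (_∈_; lose; find)
open import Data.List.Membership.Propositional.Properties
  using (∈-filter⁺; ∈-filter⁻; ∈-allFin; ∈-cartesianProduct⁺; ∈-map⁺; ∈-++⁺ˡ)
open import Data.List.Relation.Binary.Permutation.Propositional using (↭-refl)
open import Data.List.Relation.Binary.Permutation.Propositional.Properties using (↭-length)
open import Data.List.Relation.Binary.Pointwise as Pointwise using (Pointwise)
import Data.List.Relation.Binary.Pointwise.Properties as Pointwise
open import Data.List.Relation.Binary.Sublist.Propositional using (_⊆_; []; _∷_; _∷ʳ_; ⊆-refl)
open import Data.List.Relation.Binary.Sublist.Propositional.Properties using (All-resp-⊆)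
open import Data.List.Relation.Unary.All as All using (All; []; _∷_)
import Data.List.Relation.Unary.All.Properties as All
open import Data.List.Relation.Unary.AllPairs as AllPairs using (AllPairs; []; _∷_)
import Data.List.Relation.Unary.AllPairs.Properties as AllPairs
open import Data.List.Relation.Unary.Any as Any using (Any; here; there)
import Data.List.Relation.Unary.Any.Properties as Any
open import Data.List.Relation.Unary.Unique.Propositional using (Unique)
import Data.List.Relation.Unary.Unique.Propositional.Properties as Unique
open import Data.Nat using (ℕ; zero; suc; _+_; _*_; _∸_; _≤_; _<_; z≤n; s≤s; s≤s⁻¹)
open import Data.Nat.ListAction using (sum)
open import Data.Nat.Properties
open import Data.Product using (∃₂; ∃-syntax; _×_; _,_; proj₁; proj₂)
open import Data.Sum using (_⊎_; inj₁; inj₂)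
open import Effect.Monad using (RawMonad)
open import Function using (_∘_)
open import Function.Bundles using (mk⇔; Equivalence)
open import Level using (0ℓ)
open import Relation.Binary using (Rel; Symmetric; Transitive; DecidableEquality)
open import Relation.Binary.PropositionalEquality
open import Relation.Nullary using (¬_; yes; no; ¬?)
open import Relation.Nullary.Decidable using (decidable-stable; ¬¬-excluded-middle)
open import Relation.Nullary.Negation using (DoubleNegation; ¬¬-Monad)
open import Relation.Unary using (Decidable)

open RawMonad (¬¬-Monad {0ℓ}) using (pure; _>>=_)

-- Orbits and independent lists

module _ {n : ℕ} where

  orbit-trans : ∀ {G} → Transitive (Orbit {n} G)
  orbit-trans p here        = p
  orbit-trans p (step f∈ q) = step f∈ (orbit-trans p q)

  orbit-edge : ∀ {G f} x → f ∈ G → Orbit {n} G x (f x)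
  orbit-edge x f∈ = step f∈ here

  orbit-sym : ∀ {G} → All (Involutive _≡_) G → Symmetric (Orbit {n} G)
  orbit-sym invs here = here
  orbit-sym invs (step {f} {y} f∈ p) =
    orbit-trans (subst (Orbit _ (f y)) (All.lookup invs f∈ y) (orbit-edge (f y) f∈)) (orbit-sym invs p)

  orbit-mono : ∀ {G G′} → (∀ {f} → f ∈ G → ∀ y → Orbit {n} G′ y (f y)) →
               ∀ {x y} → Orbit G x y → Orbit G′ x y
  orbit-mono gen here        = here
  orbit-mono gen (step f∈ p) = orbit-trans (orbit-mono gen p) (gen f∈ _)

  τ-involutive : Involutive _≡_ (τ {n})
  τ-involutive (i , false) = refl
  τ-involutive (i , true)  = refl

  τ-fixedPointFree : ∀ (x : Pt n) → τ x ≢ x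
  τ-fixedPointFree (i , false) ()
  τ-fixedPointFree (i , true)  ()

  Conn-cong : ∀ {ρ ρ′ : Pt n → Pt n} → ρ ≗ ρ′ → ∀ {x y} → Conn ρ x y → Conn ρ′ x y
  Conn-cong {ρ} {ρ′} ρ≗ρ′ = orbit-mono gen
    where
    gen : ∀ {f} → f ∈ τ ∷ ρ ∷ [] → ∀ y → Conn ρ′ y (f y)
    gen (here refl)         y = orbit-edge y (here refl)
    gen (there (here refl)) y = subst (Conn ρ′ y) (sym (ρ≗ρ′ y)) (orbit-edge y (there (here refl)))

  Conn-sym : ∀ {ρ : Pt n → Pt n} → Involutive _≡_ ρ → Symmetric (Conn ρ)
  Conn-sym ρ-inv = orbit-sym (τ-involutive ∷ ρ-inv ∷ [])

Independent : {A : Set} → Rel A 0ℓ → List A → Set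
Independent R = AllPairs (λ a b → ¬ R a b)

module _ {A : Set} {R : Rel A 0ℓ} (R-sym : Symmetric R) (R-trans : Transitive R) where

  drop-class : ∀ p J → Independent R J →
    DoubleNegation (∃[ K ] K ⊆ J × Independent R K × All (λ k → ¬ R k p) K × length J ≤ suc (length K))
  drop-class p []      []         = pure ([] , [] , [] , [] , z≤n)
  drop-class p (j ∷ J) (j⊥J ∷ J⊥) = do
    yes Rjp ← ¬¬-excluded-middle {A = R j p}
      where no ¬Rjp → do
              (K , K⊆J , K⊥ , K⊥p , len) ← drop-class p J J⊥
              pure (j ∷ K , refl ∷ K⊆J , All-resp-⊆ K⊆J j⊥J ∷ K⊥ , ¬Rjp ∷ K⊥p , s≤s len)
    pure (J , j ∷ʳ ⊆-refl , J⊥ , All.map (λ ¬Rjk Rkp → ¬Rjk (R-trans Rjp (R-sym Rkp))) j⊥J , ≤-refl)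

  independent≤cover : ∀ I T → Independent R I → All (λ i → Any (λ t → R t i) T) I →
    DoubleNegation (length I ≤ length T)
  independent≤cover []      T       _  _             = pure z≤n
  independent≤cover (_ ∷ _) []      _  (() ∷ _)
  independent≤cover I       (t ∷ T) I⊥ covered = do
    (K , K⊆I , K⊥ , K⊥t , len) ← drop-class t I I⊥
    K≤T ← independent≤cover K T K⊥ (All.zipWith covered-by-T (All-resp-⊆ K⊆I covered , K⊥t))
    pure (≤-trans len (s≤s K≤T))
    where
    covered-by-T : ∀ {k} → Any (λ t′ → R t′ k) (t ∷ T) × ¬ R k t → Any (λ t′ → R t′ k) T
    covered-by-T (here Rtk , ¬Rkt) = ⊥-elim (¬Rkt (R-sym Rtk))
    covered-by-T (there a  , _)    = a

-- Conjugation by a transposition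

module _ {n : ℕ} where

  data SwapCase (a b x y : Pt n) : Set where
    at-left   : x ≡ a → y ≡ b → SwapCase a b x y
    at-right  : x ≢ a → x ≡ b → y ≡ a → SwapCase a b x y
    elsewhere : x ≢ a → x ≢ b → y ≡ x → SwapCase a b x y

  swap-case : ∀ a b x → SwapCase a b x (swap a b x)
  swap-case a b x with x ≟P a
  ... | yes x≡a = at-left x≡a refl
  ... | no x≢a with x ≟P b
  ...   | yes x≡b = at-right x≢a x≡b refl
  ...   | no x≢b  = elsewhere x≢a x≢b refl

  swap-left : ∀ a b → swap a b a ≡ b
  swap-left a b with swap-case a b a
  ... | at-left _ e         = e
  ... | at-right a≢a _ _    = ⊥-elim (a≢a refl)
  ... | elsewhere a≢a _ _   = ⊥-elim (a≢a refl)

  swap-right : ∀ {a b} → a ≢ b → swap a b b ≡ a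
  swap-right {a} {b} a≢b with swap-case a b b
  ... | at-left b≡a _       = ⊥-elim (a≢b (sym b≡a))
  ... | at-right _ _ e      = e
  ... | elsewhere _ b≢b _   = ⊥-elim (b≢b refl)

  swap-elsewhere : ∀ {a b x} → x ≢ a → x ≢ b → swap a b x ≡ x
  swap-elsewhere {a} {b} {x} x≢a x≢b with swap-case a b x
  ... | at-left x≡a _       = ⊥-elim (x≢a x≡a)
  ... | at-right _ x≡b _    = ⊥-elim (x≢b x≡b)
  ... | elsewhere _ _ e     = e

  swap-involutive : ∀ {a b} → a ≢ b → Involutive _≡_ (swap a b)
  swap-involutive {a} {b} a≢b x with swap-case a b x
  ... | at-left refl e      = trans (cong (swap a b) e) (swap-right a≢b)
  ... | at-right _ refl e   = trans (cong (swap a b) e) (swap-left a b)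
  ... | elsewhere _ _ e     = trans (cong (swap a b) e) e

  left right : Transp n → Pt n
  left  σ = Transp.p σ
  right σ = (Transp.q σ , false)

  left≢right : ∀ σ → left σ ≢ right σ
  left≢right σ e = <-irrefl (cong rank e) (Transp.p<q σ)

  transpFun-involutive : ∀ σ → Involutive _≡_ (transpFun σ)
  transpFun-involutive σ = swap-involutive (left≢right σ)

  conj-involutive : ∀ σ ρ → Involutive _≡_ ρ → Involutive _≡_ (conj σ ρ)
  conj-involutive σ ρ ρ-inv x = begin
    transpFun σ (ρ (transpFun σ (transpFun σ (ρ (transpFun σ x)))))
      ≡⟨ cong (transpFun σ ∘ ρ) (transpFun-involutive σ _) ⟩
    transpFun σ (ρ (ρ (transpFun σ x)))
      ≡⟨ cong (transpFun σ) (ρ-inv _) ⟩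
    transpFun σ (transpFun σ x)
      ≡⟨ transpFun-involutive σ x ⟩
    x ∎
    where open ≡-Reasoning

  conj-FPFInv : ∀ σ ρ → FPFInv ρ → FPFInv (conj σ ρ)
  conj-FPFInv σ ρ (ρ-inv , ρ-fpf) =
    conj-involutive σ ρ ρ-inv ,
    λ x e → ρ-fpf (transpFun σ x) (trans (sym (transpFun-involutive σ _)) (cong (transpFun σ) e))

  conj-conj : ∀ σ ρ → conj σ (conj σ ρ) ≗ ρ
  conj-conj σ ρ x = trans (transpFun-involutive σ _) (cong ρ (transpFun-involutive σ x))

  act-++ : ∀ σs τs (ρ : Pt n → Pt n) → act (σs ++ τs) ρ ≡ act τs (act σs ρ)
  act-++ []       τs ρ = refl
  act-++ (σ ∷ σs) τs ρ = act-++ σs τs (conj σ ρ)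

  act-cong : ∀ σs {ρ ρ′ : Pt n → Pt n} → ρ ≗ ρ′ → act σs ρ ≗ act σs ρ′
  act-cong []       e = e
  act-cong (σ ∷ σs) e = act-cong σs (λ x → cong (transpFun σ) (e _))

  act-reverse : ∀ σs (ρ : Pt n → Pt n) → act (reverse σs) (act σs ρ) ≗ ρ
  act-reverse []       ρ x = refl
  act-reverse (σ ∷ σs) ρ x rewrite unfold-reverse σ σs | act-++ (reverse σs) (σ ∷ []) (act σs (conj σ ρ)) =
    trans (cong (transpFun σ) (act-reverse σs (conj σ ρ) _)) (conj-conj σ ρ x)

module _ {n : ℕ} (σ : Transp n) {ρ : Pt n → Pt n} (ρ-inv : Involutive _≡_ ρ) where

  private
    p q : Pt n
    p = left σ
    q = right σ

    ρ′ : Pt n → Pt n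
    ρ′ = conj σ ρ

    conj-edge : ∀ {x y} → Conn ρ x y → Conn ρ x (ρ′ y) ⊎ Conn ρ x p ⊎ Conn ρ x q
    conj-edge {y = y} c with swap-case p q y
    ... | at-left refl _     = inj₂ (inj₁ c)
    ... | at-right _ refl _  = inj₂ (inj₂ c)
    ... | elsewhere _ _ σy≡y with swap-case p q (ρ y) | step (there (here refl)) c
    ...   | at-left ρy≡p _     | c′ = inj₂ (inj₁ (subst (Conn ρ _) ρy≡p c′))
    ...   | at-right _ ρy≡q _  | c′ = inj₂ (inj₂ (subst (Conn ρ _) ρy≡q c′))
    ...   | elsewhere _ _ e    | c′ = inj₁ (subst (Conn ρ _) (sym (trans (cong (transpFun σ ∘ ρ) σy≡y) e)) c′)

  Conn-conj : ∀ {x y} → Conn ρ′ x y → Conn ρ x y ⊎ Conn ρ x p ⊎ Conn ρ x q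
  Conn-conj here = inj₁ here
  Conn-conj (step (here refl) c) with Conn-conj c
  ... | inj₁ c′ = inj₁ (step (here refl) c′)
  ... | inj₂ d  = inj₂ d
  Conn-conj (step (there (here refl)) c) with Conn-conj c
  ... | inj₁ c′ = conj-edge c′
  ... | inj₂ d  = inj₂ d

  Conn-conj-avoiding : ∀ {x y} → ¬ Conn ρ x p → ¬ Conn ρ x q → Conn ρ′ x y → Conn ρ x y
  Conn-conj-avoiding ¬xp ¬xq c with Conn-conj c
  ... | inj₁ xy          = xy
  ... | inj₂ (inj₁ xp)   = ⊥-elim (¬xp xp)
  ... | inj₂ (inj₂ xq)   = ⊥-elim (¬xq xq)

  private
    Avoiding : Pt n → Set
    Avoiding k = ¬ Conn ρ k p × ¬ Conn ρ k q

    independent-avoiding : ∀ {K} → Independent (Conn ρ) K → All Avoiding K → Independent (Conn ρ′) K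
    independent-avoiding []         []                  = []
    independent-avoiding (k⊥K ∷ K⊥) ((¬kp , ¬kq) ∷ avK) =
      All.map (λ ¬kk′ c → ¬kk′ (Conn-conj-avoiding ¬kp ¬kq c)) k⊥K ∷ independent-avoiding K⊥ avK

    separated-avoiding : ∀ {x} → (∀ {k} → Avoiding k → ¬ Conn ρ k x) →
                         ∀ {K} → All Avoiding K → All (λ k → ¬ Conn ρ′ x k) K
    separated-avoiding k↛x = All.map λ av@(¬kp , ¬kq) c →
      k↛x av (Conn-conj-avoiding ¬kp ¬kq (Conn-sym (conj-involutive σ ρ ρ-inv) c))

  independent-conj : ∀ J → Independent (Conn ρ) J →
    DoubleNegation (∃[ J′ ] Independent (Conn ρ′) J′ × length J ≤ suc (length J′))
  independent-conj J J⊥ = do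
    (K₁ , _     , K₁⊥ , K₁⊥p , J≤K₁) ← drop-class (Conn-sym ρ-inv) orbit-trans p J J⊥
    (K₂ , K₂⊆K₁ , K₂⊥ , K₂⊥q , K₁≤K₂) ← drop-class (Conn-sym ρ-inv) orbit-trans q K₁ K₁⊥
    let avK₂ : All Avoiding K₂
        avK₂ = All.zip (All-resp-⊆ K₂⊆K₁ K₁⊥p , K₂⊥q)
    pure (p ∷ K₂ , separated-avoiding proj₁ avK₂ ∷ independent-avoiding K₂⊥ avK₂ , ≤-trans J≤K₁ (s≤s K₁≤K₂))

  independent-conj-split : Conn ρ p q → ¬ Conn ρ′ p q → ∀ J → Independent (Conn ρ) J →
    DoubleNegation (∃[ J′ ] Independent (Conn ρ′) J′ × suc (length J) ≤ length J′)
  independent-conj-split pq ¬pq′ J J⊥ = do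
    (K , _ , K⊥ , K⊥p , J≤K) ← drop-class (Conn-sym ρ-inv) orbit-trans p J J⊥
    let avK : All Avoiding K
        avK = All.map (λ ¬kp → ¬kp , λ kq → ¬kp (orbit-trans kq (Conn-sym ρ-inv pq))) K⊥p
    pure (p ∷ q ∷ K ,
          (¬pq′ ∷ separated-avoiding proj₁ avK) ∷ separated-avoiding proj₂ avK ∷ independent-avoiding K⊥ avK ,
          s≤s J≤K)

GroupOrbit : ∀ {n} → List (Transp n) → (Pt n → Pt n) → Rel (Pt n) 0ℓ
GroupOrbit σs ρ = Orbit (τ ∷ ρ ∷ map transpFun σs)

GroupOrbit-sym : ∀ {n} σs {ρ : Pt n → Pt n} → Involutive _≡_ ρ → Symmetric (GroupOrbit σs ρ)
GroupOrbit-sym σs ρ-inv =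
  orbit-sym (τ-involutive ∷ ρ-inv ∷ All.map⁺ (All.tabulate λ {σ} _ → transpFun-involutive σ))

Conn⊆GroupOrbit : ∀ {n} σs {ρ : Pt n → Pt n} {x y} → Conn ρ x y → GroupOrbit σs ρ x y
Conn⊆GroupOrbit σs {ρ} = orbit-mono gen
  where
  gen : ∀ {f} → f ∈ τ ∷ ρ ∷ [] → ∀ y → GroupOrbit σs ρ y (f y)
  gen (here refl)         y = orbit-edge y (here refl)
  gen (there (here refl)) y = orbit-edge y (there (here refl))

Covers : {A : Set} → Rel A 0ℓ → List A → Set
Covers R T = ∀ x → Any (λ t → R t x) T

module _ {n : ℕ} (σ : Transp n) (σs : List (Transp n)) {ρ : Pt n → Pt n} (ρ-inv : Involutive _≡_ ρ) where

  private
    p q : Pt n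
    p = left σ
    q = right σ

    ρ′ : Pt n → Pt n
    ρ′ = conj σ ρ

    O O′ : Rel (Pt n) 0ℓ
    O  = GroupOrbit (σ ∷ σs) ρ
    O′ = GroupOrbit σs ρ′

    O′-sym : Symmetric O′
    O′-sym = GroupOrbit-sym σs (conj-involutive σ ρ ρ-inv)

    Near : Pt n → Set
    Near z = O′ z p ⊎ O′ z q

    near-trans : ∀ {y z} → Near y → O′ y z → Near z
    near-trans (inj₁ yp) yz = inj₁ (orbit-trans (O′-sym yz) yp)
    near-trans (inj₂ yq) yz = inj₂ (orbit-trans (O′-sym yz) yq)

  OrbitOrNear : Pt n → Pt n → Set
  OrbitOrNear x y = O′ x y ⊎ Near x × Near y

  private
    near-back : ∀ {x y} → OrbitOrNear x y → Near y → Near x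
    near-back (inj₁ xy)       ny = near-trans ny (O′-sym xy)
    near-back (inj₂ (nx , _)) _  = nx

    extend-O′ : ∀ {x y z} → OrbitOrNear x y → O′ y z → OrbitOrNear x z
    extend-O′ (inj₁ xy)        yz = inj₁ (orbit-trans xy yz)
    extend-O′ (inj₂ (nx , ny)) yz = inj₂ (nx , near-trans ny yz)

    extend-σ : ∀ {x} y → OrbitOrNear x y → OrbitOrNear x (transpFun σ y)
    extend-σ y w with swap-case p q y
    ... | at-left refl σy≡q  = subst (OrbitOrNear _) (sym σy≡q) (inj₂ (near-back w (inj₁ here) , inj₂ here))
    ... | at-right _ refl σy≡p = subst (OrbitOrNear _) (sym σy≡p) (inj₂ (near-back w (inj₂ here) , inj₁ here))
    ... | elsewhere _ _ σy≡y = subst (OrbitOrNear _) (sym σy≡y) w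

  -- As ρ = σ (σ.ρ) σ, adding σ to the generators can only fuse the orbits of p and q.
  GroupOrbit-conj : ∀ {x y} → O x y → OrbitOrNear x y
  GroupOrbit-conj here = inj₁ here
  GroupOrbit-conj (step (here refl) c) = extend-O′ (GroupOrbit-conj c) (orbit-edge _ (here refl))
  GroupOrbit-conj (step {y = y} (there (here refl)) c) =
    subst (OrbitOrNear _) (conj-conj σ ρ y)
      (extend-σ _ (extend-O′ (extend-σ y (GroupOrbit-conj c)) (orbit-edge _ (there (here refl)))))
  GroupOrbit-conj (step (there (there (here refl))) c) = extend-σ _ (GroupOrbit-conj c)
  GroupOrbit-conj (step (there (there (there σ∈))) c) =
    extend-O′ (GroupOrbit-conj c) (orbit-edge _ (there (there σ∈)))

  GroupOrbit-conj-joined : Conn ρ′ p q → ∀ {x y} → O x y → O′ x y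
  GroupOrbit-conj-joined pq c with GroupOrbit-conj c
  ... | inj₁ xy         = xy
  ... | inj₂ (nx , ny)  = orbit-trans (to-p nx) (O′-sym (to-p ny))
    where
    to-p : ∀ {z} → Near z → O′ z p
    to-p (inj₁ zp) = zp
    to-p (inj₂ zq) = orbit-trans zq (O′-sym (Conn⊆GroupOrbit σs pq))

  covers-conj : ∀ T → Covers O T → DoubleNegation (∃[ T′ ] Covers O′ T′ × length T′ ≡ suc (length T))
  covers-conj T cov = do
    yes p-covered ← ¬¬-excluded-middle {A = Any (λ t → O′ t p) T}
      where no p-uncovered → pure (p ∷ T , covered (via-p p-uncovered) , refl)
    pure (q ∷ T , covered (via-q p-covered) , refl)
    where
    covered : ∀ {T′} → (∀ {t x} → t ∈ T → OrbitOrNear t x → Any (λ t′ → O′ t′ x) T′) → Covers O′ T′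
    covered via x = let (t , t∈T , tx) = find (cov x) in via t∈T (GroupOrbit-conj tx)

    via-q : Any (λ t → O′ t p) T → ∀ {t x} → t ∈ T → OrbitOrNear t x → Any (λ t′ → O′ t′ x) (q ∷ T)
    via-q _  t∈T (inj₁ tx)            = there (lose t∈T tx)
    via-q pc _   (inj₂ (_ , inj₁ xp)) = there (Any.map (λ tp → orbit-trans tp (O′-sym xp)) pc)
    via-q _  _   (inj₂ (_ , inj₂ xq)) = here (O′-sym xq)

    via-p : ¬ Any (λ t → O′ t p) T → ∀ {t x} → t ∈ T → OrbitOrNear t x → Any (λ t′ → O′ t′ x) (p ∷ T)
    via-p _  t∈T (inj₁ tx)                   = there (lose t∈T tx)
    via-p np t∈T (inj₂ (inj₁ tp , _))        = ⊥-elim (np (lose t∈T tp))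
    via-p _  _   (inj₂ (inj₂ _ , inj₁ xp))   = here (O′-sym xp)
    via-p _  t∈T (inj₂ (inj₂ tq , inj₂ xq))  = there (lose t∈T (orbit-trans tq (O′-sym xq)))

-- Parity

data Even : ℕ → Set where
  even-zero : Even 0
  even-2+   : ∀ {m} → Even m → Even (suc (suc m))

¬Even-suc : ∀ {m} → Even m → ¬ Even (suc m)
¬Even-suc even-zero  ()
¬Even-suc (even-2+ e) (even-2+ e′) = ¬Even-suc e e′

module InvolutionParity {A : Set} (_≟_ : DecidableEquality A) where

  _without_ : List A → A → List A
  L without a = filter (λ y → ¬? (y ≟ a)) L

  ∈-without⁻ : ∀ {a y} L → y ∈ L without a → y ∈ L × y ≢ a
  ∈-without⁻ {a} L = ∈-filter⁻ (λ y → ¬? (y ≟ a))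

  ∈-without⁺ : ∀ {a y L} → y ∈ L → y ≢ a → y ∈ L without a
  ∈-without⁺ {a} = ∈-filter⁺ (λ y → ¬? (y ≟ a))

  without-unique : ∀ {a L} → Unique L → Unique (L without a)
  without-unique {a} = Unique.filter⁺ (λ y → ¬? (y ≟ a))

  length-without : ∀ {a L} → Unique L → a ∈ L → length L ≡ suc (length (L without a))
  length-without {a} {y ∷ L} (y∉L ∷ _) (here refl) = cong (suc ∘ length) (sym (begin
    (y ∷ L) without y ≡⟨ filter-reject (λ z → ¬? (z ≟ y)) (λ y≢y → y≢y refl) ⟩
    L without y       ≡⟨ filter-all (λ z → ¬? (z ≟ y)) (All.map (λ y≢z z≡y → y≢z (sym z≡y)) y∉L) ⟩
    L                 ∎))
    where open ≡-Reasoning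
  length-without {a} {y ∷ L} (y∉L ∷ L!) (there a∈L) =
    trans (cong suc (length-without L! a∈L))
          (cong (suc ∘ length) (sym (filter-accept (λ z → ¬? (z ≟ a)) (All.lookup y∉L a∈L))))

  module _ (g : A → A) (g-inv : Involutive _≡_ g) (g-fpf : ∀ x → g x ≢ x) where

    even-length-closed : ∀ L → Unique L → (∀ {x} → x ∈ L → g x ∈ L) → Even (length L)
    even-length-closed L = even-of-length (length L) L refl
      where
      even-of-length : ∀ k L → length L ≡ k → Unique L → (∀ {x} → x ∈ L → g x ∈ L) → Even k
      even-of-length zero          _       _   _ _ = even-zero
      even-of-length (suc zero)    (x ∷ []) _  _ closed with closed (here refl)
      ... | here gx≡x = ⊥-elim (g-fpf x gx≡x)
      even-of-length (suc (suc k)) (x ∷ L) len (x∉L ∷ L!) closed =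
        even-2+ (even-of-length k (L without g x) len′ (without-unique L!) closed′)
        where
        gx∈L : g x ∈ L
        gx∈L with closed (here refl)
        ... | here gx≡x = ⊥-elim (g-fpf x gx≡x)
        ... | there gx∈L = gx∈L

        len′ : length (L without g x) ≡ k
        len′ = suc-injective (trans (sym (length-without L! gx∈L)) (suc-injective len))

        closed′ : ∀ {y} → y ∈ L without g x → g y ∈ L without g x
        closed′ {y} y∈ with ∈-without⁻ L y∈
        ... | y∈L , y≢gx with closed (there y∈L)
        ...   | here gy≡x  = ⊥-elim (y≢gx (trans (sym (g-inv y)) (cong g gy≡x)))
        ...   | there gy∈L = ∈-without⁺ gy∈L λ gy≡gx →
          All.lookup x∉L y∈L (sym (trans (sym (g-inv y)) (trans (cong g gy≡gx) (g-inv x))))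

module _ {n : ℕ} where

  points : List (Pt n)
  points = cartesianProduct (allFin n) (false ∷ true ∷ [])

  ∈-points : ∀ x → x ∈ points
  ∈-points (i , false) = ∈-cartesianProduct⁺ (∈-allFin i) (here refl)
  ∈-points (i , true)  = ∈-cartesianProduct⁺ (∈-allFin i) (there (here refl))

  points-unique : Unique points
  points-unique = Unique.cartesianProduct⁺ (Unique.allFin⁺ n) (((λ ()) ∷ []) ∷ [] ∷ [])

  Enumeration : (Pt n → Set) → Set
  Enumeration P = ∃[ L ] Unique L × (∀ {x} → x ∈ L → P x) × (∀ {x} → P x → x ∈ L)

  enumerate : ∀ {P} → Decidable P → Enumeration P
  enumerate {P} P? = filter P? points , Unique.filter⁺ P? points-unique , sound , complete
    where
    sound : ∀ {x} → x ∈ filter P? points → P x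
    sound x∈ = proj₂ (∈-filter⁻ P? {xs = points} x∈)
    complete : ∀ {x} → P x → x ∈ filter P? points
    complete {x} = ∈-filter⁺ P? (∈-points x)

  ¬¬-enumerate : ∀ P → DoubleNegation (Enumeration P)
  ¬¬-enumerate P = do
    P?s ← All.sequenceM 0ℓ ¬¬-Monad (All.tabulate {xs = points} λ _ → ¬¬-excluded-middle {A = P _})
    pure (enumerate λ x → All.lookup P?s (∈-points x))

-- If p and q stayed apart, the points joined to p under σ.ρ and to q under ρ would form a τ-closed
-- set that is still ρ-closed after removing ρ q; it cannot have both even and odd size.
conj-joins : ∀ {n} (σ : Transp n) {ρ : Pt n → Pt n} → FPFInv ρ →
  ¬ Conn ρ (left σ) (right σ) → DoubleNegation (Conn (conj σ ρ) (left σ) (right σ))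
conj-joins {n} σ {ρ} (ρ-inv , ρ-fpf) ¬pq ¬pq′ = ¬¬-enumerate Shared parity-clash
  where
  p q e : Pt n
  p = left σ
  q = right σ
  e = ρ q
  ρ′ : Pt n → Pt n
  ρ′ = conj σ ρ

  Shared : Pt n → Set
  Shared x = Conn ρ′ p x × Conn ρ q x

  ρ-edge : ∀ {x} y → Conn ρ x y → Conn ρ x (ρ y)
  ρ-edge y c = step (there (here refl)) c

  not-q : ∀ {y} → Shared y → y ≢ q
  not-q (py , _) refl = ¬pq′ py

  not-p : ∀ {y} → Conn ρ q y → y ≢ p
  not-p qy refl = ¬pq (Conn-sym ρ-inv qy)

  ρy≢e : ∀ {y} → Shared y → ρ y ≢ e
  ρy≢e sy ρy≡ρq = not-q sy (trans (sym (ρ-inv _)) (trans (cong ρ ρy≡ρq) (ρ-inv q)))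

  ρ′p≡e : ρ′ p ≡ e
  ρ′p≡e = trans (cong (transpFun σ ∘ ρ) (swap-left p q))
                (swap-elsewhere (not-p (ρ-edge q here)) (ρ-fpf q))

  e-shared : Shared e
  e-shared = subst (Conn ρ′ p) ρ′p≡e (orbit-edge p (there (here refl))) , ρ-edge q here

  shared-τ : ∀ {y} → Shared y → Shared (τ y)
  shared-τ (py , qy) = step (here refl) py , step (here refl) qy

  shared-ρ : ∀ {y} → Shared y → y ≢ e → Shared (ρ y)
  shared-ρ {y} sy@(py , qy) y≢e = subst (Conn ρ′ p) ρ′y≡ρy (step (there (here refl)) py) , ρ-edge y qy
    where
    ρ′y≡ρy : ρ′ y ≡ ρ y
    ρ′y≡ρy = trans (cong (transpFun σ ∘ ρ) (swap-elsewhere (not-p qy) (not-q sy)))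
                   (swap-elsewhere (not-p (ρ-edge y qy)) (λ ρy≡q → y≢e (trans (sym (ρ-inv y)) (cong ρ ρy≡q))))

  parity-clash : Enumeration Shared → ⊥
  parity-clash (L , L! , sound , complete) =
    ¬Even-suc (even-length-closed ρ ρ-inv ρ-fpf (L without e) (without-unique L!) ρ-closed)
              (subst Even (length-without L! (complete e-shared))
                     (even-length-closed τ τ-involutive τ-fixedPointFree L L! τ-closed))
    where
    open InvolutionParity _≟P_
    τ-closed : ∀ {y} → y ∈ L → τ y ∈ L
    τ-closed y∈L = complete (shared-τ (sound y∈L))
    ρ-closed : ∀ {y} → y ∈ L without e → ρ y ∈ L without e
    ρ-closed y∈ with y∈L , y≢e ← ∈-without⁻ L y∈ = ∈-without⁺ (complete (shared-ρ (sound y∈L) y≢e)) (ρy≢e (sound y∈L))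

-- The lower bound

independent-bound : ∀ {n} σs (ρ : Pt n → Pt n) → FPFInv ρ → ∀ {I J T} →
  Independent (Conn (act σs ρ)) I → Independent (Conn ρ) J → Covers (GroupOrbit σs ρ) T →
  DoubleNegation (length I + length J ≤ length σs + 2 * length T)
independent-bound [] ρ (ρ-inv , _) {I} {J} {T} I⊥ J⊥ cov = do
  I≤T ← independent≤cover (Conn-sym ρ-inv) orbit-trans I T I⊥ (All.tabulate λ {x} _ → cov x)
  J≤T ← independent≤cover (Conn-sym ρ-inv) orbit-trans J T J⊥ (All.tabulate λ {x} _ → cov x)
  pure (+-mono-≤ I≤T (≤-trans J≤T (≤-reflexive (sym (+-identityʳ (length T))))))
independent-bound (σ ∷ σs) ρ ρ-fpfi@(ρ-inv , _) {I} {J} {T} I⊥ J⊥ cov = do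
  yes pq′ ← ¬¬-excluded-middle {A = Conn ρ′ (left σ) (right σ)}
    where no ¬pq′ → do
      pq″ ← conj-joins σ ρ′-fpfi ¬pq′
      (J′ , J′⊥ , J<J′) ← independent-conj-split σ ρ-inv (Conn-cong (conj-conj σ ρ) pq″) ¬pq′ J J⊥
      (T′ , T′-covers , T′≡1+T) ← covers-conj σ σs ρ-inv T cov
      bound ← independent-bound σs ρ′ ρ′-fpfi I⊥ J′⊥ T′-covers
      pure (split-step (length I) {k = length σs} {t = length T}
             (subst (λ t → length I + length J′ ≤ length σs + 2 * t) T′≡1+T bound) J<J′)
  (J′ , J′⊥ , J≤1+J′) ← independent-conj σ ρ-inv J J⊥
  bound ← independent-bound σs ρ′ ρ′-fpfi I⊥ J′⊥ λ x → Any.map (GroupOrbit-conj-joined σ σs ρ-inv pq′) (cov x)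
  pure (join-step (length I) {k = length σs} {t = length T} bound J≤1+J′)
  where
  ρ′ : Pt _ → Pt _
  ρ′ = conj σ ρ
  ρ′-fpfi : FPFInv ρ′
  ρ′-fpfi = conj-FPFInv σ ρ ρ-fpfi
  open ≤-Reasoning

  join-step : ∀ i {j j′ k t} → i + j′ ≤ k + 2 * t → j ≤ suc j′ → i + j ≤ suc k + 2 * t
  join-step i {j} {j′} {k} {t} bound j≤1+j′ = begin
    i + j          ≤⟨ +-monoʳ-≤ i j≤1+j′ ⟩
    i + suc j′     ≡⟨ +-suc i j′ ⟩
    suc (i + j′)   ≤⟨ s≤s bound ⟩
    suc k + 2 * t  ∎

  split-step : ∀ i {j j′ k t} → i + j′ ≤ k + 2 * suc t → suc j ≤ j′ → i + j ≤ suc k + 2 * t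
  split-step i {j} {j′} {k} {t} bound j<j′ = s≤s⁻¹ (begin
    suc (i + j)             ≡⟨ +-suc i j ⟨
    i + suc j               ≤⟨ +-monoʳ-≤ i j<j′ ⟩
    i + j′                  ≤⟨ bound ⟩
    k + 2 * suc t           ≡⟨ cong (k +_) (*-suc 2 t) ⟩
    k + suc (suc (2 * t))   ≡⟨ +-suc k (suc (2 * t)) ⟩
    suc (k + suc (2 * t))   ≡⟨ cong suc (+-suc k (2 * t)) ⟩
    suc (suc k + 2 * t)     ∎)

origin : ∀ {n} → 1 ≤ n → Pt n
origin 1≤n = fromℕ< 1≤n , false

representatives : ∀ {n} {ρ : Pt n → Pt n} {λs} → HasType ρ λs → ∃[ R ] Independent (Conn ρ) R × length R ≡ length λs
representatives (_ , R , _ , _ , R⊥ , sized , sizes↭λs) =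
  R , R⊥ , trans (Pointwise.Pointwise-length sized) (↭-length sizes↭λs)

lower-bound : ∀ {n k μ ν} → 1 ≤ n → TransTwistedFact n k μ ν → length μ + length ν ∸ 2 ≤ k
lower-bound {μ = μ} {ν} 1≤n (ρ , σs , refl , ρ∈ν , act∈μ , transitive)
  with Rμ , Rμ⊥ , |Rμ| ← representatives act∈μ
     | Rν , Rν⊥ , |Rν| ← representatives ρ∈ν = m≤n+o⇒m∸n≤o _ 2 (begin
    length μ + length ν    ≡⟨ cong₂ _+_ |Rμ| |Rν| ⟨
    length Rμ + length Rν  ≤⟨ decidable-stable (_ ≤? _) (independent-bound σs ρ (proj₁ ρ∈ν) Rμ⊥ Rν⊥ covers) ⟩
    length σs + 2          ≡⟨ +-comm (length σs) 2 ⟩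
    2 + length σs          ∎)
  where
  open ≤-Reasoning
  covers : Covers (GroupOrbit σs ρ) (origin 1≤n ∷ [])
  covers x = here (transitive (origin 1≤n) x)

-- Block involutions

data Offset (a : ℕ) : ℕ → Set where
  inside : ∀ {i} → i < a → Offset a i
  beyond : ∀ j → Offset a (a + j)

offset : ∀ a i → Offset a i
offset a i with i <? a
... | yes i<a = inside i<a
... | no i≮a  = subst (Offset a) (m+[n∸m]≡n (≮⇒≥ i≮a)) (beyond (i ∸ a))

cycle-next : ℕ → ℕ → ℕ
cycle-next m j with suc j ≟ m
... | yes _ = 0
... | no _  = suc j

cycle-prev : ℕ → ℕ → ℕ
cycle-prev m zero    = m ∸ 1
cycle-prev m (suc j) = j

cycle-next-last : ∀ {m j} → suc j ≡ m → cycle-next m j ≡ 0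
cycle-next-last {m} {j} 1+j≡m with suc j ≟ m
... | yes _     = refl
... | no 1+j≢m  = ⊥-elim (1+j≢m 1+j≡m)

cycle-next-inner : ∀ {m j} → suc j ≢ m → cycle-next m j ≡ suc j
cycle-next-inner {m} {j} 1+j≢m with suc j ≟ m
... | yes 1+j≡m = ⊥-elim (1+j≢m 1+j≡m)
... | no _      = refl

cycle-next-< : ∀ {m j} → j < m → cycle-next m j < m
cycle-next-< {m} {j} j<m with suc j ≟ m
... | yes _    = ≤-trans (s≤s z≤n) j<m
... | no 1+j≢m = ≤∧≢⇒< j<m 1+j≢m

cycle-prev-< : ∀ {m j} → j < m → cycle-prev m j < m
cycle-prev-< {suc m} {zero}  _   = ≤-refl
cycle-prev-< {m}     {suc j} j<m = ≤-trans (n≤1+n _) j<m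

cycle-prev-next : ∀ {m j} → j < m → cycle-prev m (cycle-next m j) ≡ j
cycle-prev-next {m} {j} _ with suc j ≟ m
... | yes 1+j≡m = cong (_∸ 1) (sym 1+j≡m)
... | no _      = refl

cycle-next-prev : ∀ {m j} → j < m → cycle-next m (cycle-prev m j) ≡ j
cycle-next-prev {suc m} {zero}  _   = cycle-next-last refl
cycle-next-prev {m}     {suc j} j<m = cycle-next-inner (λ 1+j≡m → <-irrefl 1+j≡m j<m)

blockwise : (ℕ → ℕ → ℕ) → List ℕ → ℕ → ℕ
blockwise c []       i = i
blockwise c (a ∷ λs) i with i <? a
... | yes _ = c a i
... | no _  = a + blockwise c λs (i ∸ a)

blockwise-inside : ∀ c {a} λs {i} → i < a → blockwise c (a ∷ λs) i ≡ c a i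
blockwise-inside c {a} λs {i} i<a with i <? a
... | yes _  = refl
... | no i≮a = ⊥-elim (i≮a i<a)

blockwise-beyond : ∀ c a λs j → blockwise c (a ∷ λs) (a + j) ≡ a + blockwise c λs j
blockwise-beyond c a λs j with a + j <? a
... | yes a+j<a = ⊥-elim (m+n≮m a j a+j<a)
... | no _      = cong (λ k → a + blockwise c λs k) (m+n∸m≡n a j)

module _ {c : ℕ → ℕ → ℕ} (c-< : ∀ {m j} → j < m → c m j < m) where

  blockwise-< : ∀ λs {i} → i < sum λs → blockwise c λs i < sum λs
  blockwise-< (a ∷ λs) {i} i<sum with offset a i
  ... | inside i<a = begin-strict
    blockwise c (a ∷ λs) i  ≡⟨ blockwise-inside c λs i<a ⟩
    c a i                   <⟨ c-< i<a ⟩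
    a                       ≤⟨ m≤m+n a (sum λs) ⟩
    a + sum λs              ∎
    where open ≤-Reasoning
  ... | beyond j = begin-strict
    blockwise c (a ∷ λs) (a + j)  ≡⟨ blockwise-beyond c a λs j ⟩
    a + blockwise c λs j          <⟨ +-monoʳ-< a (blockwise-< λs (+-cancelˡ-< a j (sum λs) i<sum)) ⟩
    a + sum λs                    ∎
    where open ≤-Reasoning

  blockwise-inverse : ∀ {d} → (∀ {m j} → j < m → d m (c m j) ≡ j) → ∀ λs i → blockwise d λs (blockwise c λs i) ≡ i
  blockwise-inverse d∘c []       i = refl
  blockwise-inverse {d} d∘c (a ∷ λs) i with offset a i
  ... | inside i<a = begin
    blockwise d (a ∷ λs) (blockwise c (a ∷ λs) i)  ≡⟨ cong (blockwise d (a ∷ λs)) (blockwise-inside c λs i<a) ⟩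
    blockwise d (a ∷ λs) (c a i)                   ≡⟨ blockwise-inside d λs (c-< i<a) ⟩
    d a (c a i)                                    ≡⟨ d∘c i<a ⟩
    i                                              ∎
    where open ≡-Reasoning
  ... | beyond j = begin
    blockwise d (a ∷ λs) (blockwise c (a ∷ λs) (a + j))  ≡⟨ cong (blockwise d (a ∷ λs)) (blockwise-beyond c a λs j) ⟩
    blockwise d (a ∷ λs) (a + blockwise c λs j)          ≡⟨ blockwise-beyond d a λs (blockwise c λs j) ⟩
    a + blockwise d λs (blockwise c λs j)                ≡⟨ cong (a +_) (blockwise-inverse d∘c λs j) ⟩
    a + j                                                ∎
    where open ≡-Reasoning

data Block : List ℕ → ℕ → ℕ → Set where
  first : ∀ {a λs} → Block (a ∷ λs) 0 a
  later : ∀ {a λs s m} → Block λs s m → Block (a ∷ λs) (a + s) m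

blockwise-block : ∀ c {λs s m} → Block λs s m → ∀ {j} → j < m → blockwise c λs (s + j) ≡ s + c m j
blockwise-block c (first {λs = λs})          j<m = blockwise-inside c λs j<m
blockwise-block c (later {a} {λs} {s} {m} b) {j} j<m = begin
  blockwise c (a ∷ λs) (a + s + j)    ≡⟨ cong (blockwise c (a ∷ λs)) (+-assoc a s j) ⟩
  blockwise c (a ∷ λs) (a + (s + j))  ≡⟨ blockwise-beyond c a λs (s + j) ⟩
  a + blockwise c λs (s + j)          ≡⟨ cong (a +_) (blockwise-block c b j<m) ⟩
  a + (s + c m j)                     ≡⟨ +-assoc a s (c m j) ⟨
  a + s + c m j                       ∎
  where open ≡-Reasoning

block-bound : ∀ {λs s m} → Block λs s m → s + m ≤ sum λs
block-bound (first {a} {λs})           = m≤m+n a (sum λs)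
block-bound (later {a} {λs} {s} {m} b) = begin
  a + s + m     ≡⟨ +-assoc a s m ⟩
  a + (s + m)   ≤⟨ +-monoʳ-≤ a (block-bound b) ⟩
  a + sum λs    ∎
  where open ≤-Reasoning

block-positive : ∀ {λs s m} → All (1 ≤_) λs → Block λs s m → 1 ≤ m
block-positive (1≤a ∷ _) first     = 1≤a
block-positive (_ ∷ pos) (later b) = block-positive pos b

blocks : ∀ λs → List (∃₂ (Block λs))
blocks []       = []
blocks (a ∷ λs) = (0 , a , first) ∷ map (λ (s , m , b) → a + s , m , later b) (blocks λs)

blocks-sizes : ∀ λs → map (proj₁ ∘ proj₂) (blocks λs) ≡ λs
blocks-sizes []       = refl
blocks-sizes (a ∷ λs) = cong (a ∷_) (trans (sym (map-∘ (blocks λs))) (blocks-sizes λs))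

blocks-ordered : ∀ λs → AllPairs (λ (s , m , _) (s′ , _) → s + m ≤ s′) (blocks λs)
blocks-ordered []       = []
blocks-ordered (a ∷ λs) =
  All.map⁺ (All.tabulate λ _ → m≤m+n a _) ∷
  AllPairs.map⁺ (AllPairs.map (λ {(s , m , _)} {(s′ , _)} s+m≤s′ →
    ≤-trans (≤-reflexive (+-assoc a s m)) (+-monoʳ-≤ a s+m≤s′)) (blocks-ordered λs))

blocks-cover : ∀ λs {i} → i < sum λs → Any (λ (s , m , _) → s ≤ i × i < s + m) (blocks λs)
blocks-cover (a ∷ λs) {i} i<sum with offset a i
... | inside i<a = here (z≤n , i<a)
... | beyond j   = there (Any.map⁺ (Any.map (λ {(s , m , _)} (s≤j , j<s+m) →
      +-monoʳ-≤ a s≤j , subst (a + j <_) (sym (+-assoc a s m)) (+-monoʳ-< a j<s+m))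
      (blocks-cover λs (+-cancelˡ-< a j (sum λs) i<sum))))

next prev : List ℕ → ℕ → ℕ
next = blockwise cycle-next
prev = blockwise cycle-prev

prev-next : ∀ λs i → prev λs (next λs i) ≡ i
prev-next = blockwise-inverse cycle-next-< cycle-prev-next

next-prev : ∀ λs i → next λs (prev λs i) ≡ i
next-prev = blockwise-inverse cycle-prev-< cycle-next-prev

swap0 : ℕ → ℕ → ℕ
swap0 a zero    = a
swap0 a (suc i) with suc i ≟ a
... | yes _ = 0
... | no _  = suc i

swap0-self : ∀ a → swap0 a a ≡ 0
swap0-self zero    = refl
swap0-self (suc a) with suc a ≟ suc a
... | yes _    = refl
... | no a≢a   = ⊥-elim (a≢a refl)

swap0-other : ∀ {a i} → i ≢ 0 → i ≢ a → swap0 a i ≡ i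
swap0-other {a} {zero}  i≢0 _   = ⊥-elim (i≢0 refl)
swap0-other {a} {suc i} _   i≢a with suc i ≟ a
... | yes i≡a = ⊥-elim (i≢a i≡a)
... | no _    = refl

swap0-involutive : ∀ a → Involutive _≡_ (swap0 a)
swap0-involutive a zero    = swap0-self a
swap0-involutive a (suc i) with suc i ≟ a
... | yes i≡a = sym i≡a
... | no i≢a  = swap0-other (λ ()) i≢a

module _ {a b : ℕ} (1≤a : 1 ≤ a) (1≤b : 1 ≤ b) where

  private
    1+i≢a+b : ∀ {i} → i < a → suc i ≢ a + b
    1+i≢a+b i<a e = <-irrefl e (≤-<-trans i<a (m<m+n a 1≤b))

    merge-first : ∀ {i} → i < a → swap0 a (cycle-next a i) ≡ cycle-next (a + b) i
    merge-first {i} i<a with suc i ≟ a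
    ... | yes 1+i≡a = sym (trans (cycle-next-inner (1+i≢a+b i<a)) 1+i≡a)
    ... | no 1+i≢a  = trans (swap0-other (λ ()) 1+i≢a) (sym (cycle-next-inner (1+i≢a+b i<a)))

    merge-second : ∀ {j} → j < b → swap0 a (a + cycle-next b j) ≡ cycle-next (a + b) (a + j)
    merge-second {j} j<b with suc j ≟ b
    ... | yes 1+j≡b = begin
      swap0 a (a + 0)             ≡⟨ cong (swap0 a) (+-identityʳ a) ⟩
      swap0 a a                   ≡⟨ swap0-self a ⟩
      0                           ≡⟨ cycle-next-last (trans (sym (+-suc a j)) (cong (a +_) 1+j≡b)) ⟨
      cycle-next (a + b) (a + j)  ∎
      where open ≡-Reasoning
    ... | no 1+j≢b = begin
      swap0 a (a + suc j)         ≡⟨ swap0-other (λ e → 1+n≢0 (trans (sym (+-suc a j)) e)) (m+1+n≢m a) ⟩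
      a + suc j                   ≡⟨ +-suc a j ⟩
      suc (a + j)                 ≡⟨ cycle-next-inner (λ e → 1+j≢b (+-cancelˡ-≡ a _ _ (trans (+-suc a j) e))) ⟨
      cycle-next (a + b) (a + j)  ∎
      where open ≡-Reasoning

    merge-rest : ∀ k → swap0 a (a + (b + k)) ≡ a + (b + k)
    merge-rest k = swap0-other (λ e → <-irrefl (sym e) (≤-trans 1≤a (m≤m+n a _)))
                               (λ e → <-irrefl (sym (+-cancelˡ-≡ a _ 0 (trans e (sym (+-identityʳ a)))))
                                               (≤-trans 1≤b (m≤m+n b k)))

  next-merge : ∀ r i → swap0 a (next (a ∷ b ∷ r) i) ≡ next (a + b ∷ r) i
  next-merge r i with offset a i
  ... | inside i<a = begin
    swap0 a (next (a ∷ b ∷ r) i)  ≡⟨ cong (swap0 a) (blockwise-inside cycle-next (b ∷ r) i<a) ⟩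
    swap0 a (cycle-next a i)      ≡⟨ merge-first i<a ⟩
    cycle-next (a + b) i          ≡⟨ blockwise-inside cycle-next r (<-≤-trans i<a (m≤m+n a b)) ⟨
    next (a + b ∷ r) i            ∎
    where open ≡-Reasoning
  ... | beyond j with offset b j
  ...   | inside j<b = begin
    swap0 a (next (a ∷ b ∷ r) (a + j))  ≡⟨ cong (swap0 a) (blockwise-beyond cycle-next a (b ∷ r) j) ⟩
    swap0 a (a + next (b ∷ r) j)        ≡⟨ cong (λ x → swap0 a (a + x)) (blockwise-inside cycle-next r j<b) ⟩
    swap0 a (a + cycle-next b j)        ≡⟨ merge-second j<b ⟩
    cycle-next (a + b) (a + j)          ≡⟨ blockwise-inside cycle-next r (+-monoʳ-< a j<b) ⟨
    next (a + b ∷ r) (a + j)            ∎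
    where open ≡-Reasoning
  ...   | beyond k = begin
    swap0 a (next (a ∷ b ∷ r) (a + (b + k)))  ≡⟨ cong (swap0 a) (blockwise-beyond cycle-next a (b ∷ r) (b + k)) ⟩
    swap0 a (a + next (b ∷ r) (b + k))        ≡⟨ cong (λ x → swap0 a (a + x)) (blockwise-beyond cycle-next b r k) ⟩
    swap0 a (a + (b + next r k))              ≡⟨ merge-rest (next r k) ⟩
    a + (b + next r k)                        ≡⟨ +-assoc a b (next r k) ⟨
    a + b + next r k                          ≡⟨ blockwise-beyond cycle-next (a + b) r k ⟨
    next (a + b ∷ r) (a + b + k)              ≡⟨ cong (next (a + b ∷ r)) (+-assoc a b k) ⟩
    next (a + b ∷ r) (a + (b + k))            ∎
    where open ≡-Reasoning

  prev-merge : ∀ r i → prev (a ∷ b ∷ r) (swap0 a i) ≡ prev (a + b ∷ r) i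
  prev-merge r i = begin
    prev (a ∷ b ∷ r) (swap0 a i)
      ≡⟨ cong (prev (a ∷ b ∷ r) ∘ swap0 a) (next-prev (a + b ∷ r) i) ⟨
    prev (a ∷ b ∷ r) (swap0 a (next (a + b ∷ r) j))
      ≡⟨ cong (prev (a ∷ b ∷ r) ∘ swap0 a) (next-merge r j) ⟨
    prev (a ∷ b ∷ r) (swap0 a (swap0 a (next (a ∷ b ∷ r) j)))
      ≡⟨ cong (prev (a ∷ b ∷ r)) (swap0-involutive a _) ⟩
    prev (a ∷ b ∷ r) (next (a ∷ b ∷ r) j)
      ≡⟨ prev-next (a ∷ b ∷ r) j ⟩
    j ∎
    where
    open ≡-Reasoning
    j : ℕ
    j = prev (a + b ∷ r) i

model : List ℕ → ℕ × Bool → ℕ × Bool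
model λs (i , true)  = next λs i , false
model λs (i , false) = prev λs i , true

model-involutive : ∀ λs → Involutive _≡_ (model λs)
model-involutive λs (i , true)  = cong (_, true) (prev-next λs i)
model-involutive λs (i , false) = cong (_, false) (next-prev λs i)

model-fixedPointFree : ∀ λs y → model λs y ≢ y
model-fixedPointFree λs (i , true)  ()
model-fixedPointFree λs (i , false) ()

swap0-unbarred : ℕ → ℕ × Bool → ℕ × Bool
swap0-unbarred a (i , false) = swap0 a i , false
swap0-unbarred a (i , true)  = i , true

model-merge : ∀ {a b} → 1 ≤ a → 1 ≤ b → ∀ r y →
              swap0-unbarred a (model (a ∷ b ∷ r) (swap0-unbarred a y)) ≡ model (a + b ∷ r) y
model-merge 1≤a 1≤b r (i , true)  = cong (_, false) (next-merge 1≤a 1≤b r i)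
model-merge 1≤a 1≤b r (i , false) = cong (_, true) (prev-merge 1≤a 1≤b r i)

module _ {n : ℕ} where

  ⟦_⟧ : Pt n → ℕ × Bool
  ⟦ i , b ⟧ = toℕ i , b

  ⟦⟧-injective : ∀ {x y} → ⟦ x ⟧ ≡ ⟦ y ⟧ → x ≡ y
  ⟦⟧-injective {i , b} {j , c} e = cong₂ _,_ (toℕ-injective (cong proj₁ e)) (cong proj₂ e)

  Represents : (Pt n → Pt n) → (ℕ × Bool → ℕ × Bool) → Set
  Represents f F = ∀ x → ⟦ f x ⟧ ≡ F ⟦ x ⟧

  represents-unique : ∀ {f g F} → Represents f F → Represents g F → f ≗ g
  represents-unique f≈F g≈F x = ⟦⟧-injective (trans (f≈F x) (sym (g≈F x)))

  represents-FPFInv : ∀ {f F} → Represents f F → Involutive _≡_ F → (∀ y → F y ≢ y) → FPFInv f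
  represents-FPFInv {f} {F} f≈F F-inv F-fpf =
    (λ x → ⟦⟧-injective (trans (f≈F (f x)) (trans (cong F (f≈F x)) (F-inv ⟦ x ⟧)))) ,
    (λ x fx≡x → F-fpf ⟦ x ⟧ (trans (sym (f≈F x)) (cong ⟦_⟧ fx≡x)))

  conj-represents : ∀ σ {f S F} → Represents (transpFun σ) S → Represents f F → Represents (conj σ f) (S ∘ F ∘ S)
  conj-represents σ {f} {S} {F} σ≈S f≈F x =
    trans (σ≈S _) (cong S (trans (f≈F _) (cong F (σ≈S x))))

  canonical : ∀ λs → sum λs ≡ n → Pt n → Pt n
  canonical λs refl (i , true)  = fromℕ< (blockwise-< cycle-next-< λs (toℕ<n i)) , false
  canonical λs refl (i , false) = fromℕ< (blockwise-< cycle-prev-< λs (toℕ<n i)) , true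

  canonical-represents : ∀ λs (e : sum λs ≡ n) → Represents (canonical λs e) (model λs)
  canonical-represents λs refl (i , true)  = cong (_, false) (toℕ-fromℕ< _)
  canonical-represents λs refl (i , false) = cong (_, true) (toℕ-fromℕ< _)

module _ {n : ℕ} (1≤n : 1 ≤ n) where

  ⟦origin⟧ : ⟦ origin 1≤n ⟧ ≡ (0 , false)
  ⟦origin⟧ = cong (_, false) (toℕ-fromℕ< 1≤n)

  merger : ∀ {a} → a < n → 1 ≤ a → Transp n
  merger {a} a<n 1≤a = record
    { p   = origin 1≤n
    ; q   = fromℕ< a<n
    ; p<q = subst₂ (λ i j → 2 * i < 2 * j) (sym (toℕ-fromℕ< 1≤n)) (sym (toℕ-fromℕ< a<n)) (*-monoʳ-< 2 1≤a)
    }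

  module _ {a} (a<n : a < n) (1≤a : 1 ≤ a) where

    private
      o q : Pt n
      o = origin 1≤n
      q = fromℕ< a<n , false

      ⟦q⟧ : ⟦ q ⟧ ≡ (a , false)
      ⟦q⟧ = cong (_, false) (toℕ-fromℕ< a<n)

    merger-represents : Represents (transpFun (merger a<n 1≤a)) (swap0-unbarred a)
    merger-represents x with swap-case o q x
    ... | at-left refl σx≡q = begin
      ⟦ transpFun (merger a<n 1≤a) o ⟧  ≡⟨ cong ⟦_⟧ σx≡q ⟩
      ⟦ q ⟧                             ≡⟨ ⟦q⟧ ⟩
      swap0-unbarred a (0 , false)      ≡⟨ cong (swap0-unbarred a) ⟦origin⟧ ⟨
      swap0-unbarred a ⟦ o ⟧            ∎
      where open ≡-Reasoning
    ... | at-right _ refl σx≡o = begin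
      ⟦ transpFun (merger a<n 1≤a) q ⟧  ≡⟨ cong ⟦_⟧ σx≡o ⟩
      ⟦ o ⟧                             ≡⟨ ⟦origin⟧ ⟩
      (0 , false)                       ≡⟨ cong (_, false) (swap0-self a) ⟨
      swap0-unbarred a (a , false)      ≡⟨ cong (swap0-unbarred a) ⟦q⟧ ⟨
      swap0-unbarred a ⟦ q ⟧            ∎
      where open ≡-Reasoning
    ... | elsewhere x≢o x≢q σx≡x = trans (cong ⟦_⟧ σx≡x) (fixed x x≢o x≢q)
      where
      fixed : ∀ x → x ≢ o → x ≢ q → ⟦ x ⟧ ≡ swap0-unbarred a ⟦ x ⟧
      fixed (i , true)  _   _   = refl
      fixed (i , false) i≢0 i≢a = cong (_, false) (sym (swap0-other
        (λ e → i≢0 (⟦⟧-injective (trans (cong (_, false) e) (sym ⟦origin⟧))))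
        (λ e → i≢a (⟦⟧-injective (trans (cong (_, false) e) (sym ⟦q⟧))))))

  private
    head<n : ∀ {a b} r → 1 ≤ b → a + (b + sum r) ≡ n → a < n
    head<n {a} {b} r 1≤b e = subst (a <_) e (<-≤-trans (m<m+n a 1≤b) (+-monoʳ-≤ a (m≤m+n b (sum r))))

  mergers : ∀ a r → 1 ≤ a → All (1 ≤_) r → a + sum r ≡ n → List (Transp n)
  mergers a []      _   _           _ = []
  mergers a (b ∷ r) 1≤a (1≤b ∷ pos) e =
    merger (head<n r 1≤b e) 1≤a ∷ mergers (a + b) r (≤-trans 1≤a (m≤m+n a b)) pos (trans (+-assoc a b (sum r)) e)

  length-mergers : ∀ a r 1≤a pos e → length (mergers a r 1≤a pos e) ≡ length r
  length-mergers a []      _ _           _ = refl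
  length-mergers a (b ∷ r) _ (_ ∷ pos) _ = cong suc (length-mergers (a + b) r _ pos _)

  mergers-represents : ∀ a r 1≤a pos e {f} → Represents f (model (a ∷ r)) →
                       Represents (act (mergers a r 1≤a pos e) f) (model (n ∷ []))
  mergers-represents a []      _   _           e {f} f≈ =
    subst (λ m → Represents f (model (m ∷ []))) (trans (sym (+-identityʳ a)) e) f≈
  mergers-represents a (b ∷ r) 1≤a (1≤b ∷ pos) e f≈ =
    mergers-represents (a + b) r (≤-trans 1≤a (m≤m+n a b)) pos (trans (+-assoc a b (sum r)) e) λ x →
      trans (conj-represents (merger (head<n r 1≤b e) 1≤a) {S = swap0-unbarred a} {F = model (a ∷ b ∷ r)}
                             (merger-represents (head<n r 1≤b e) 1≤a) f≈ x)
            (model-merge 1≤a 1≤b r ⟦ x ⟧)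

blockwise-within : ∀ c → (∀ {m j} → j < m → c m j < m) → ∀ {λs s m i} → Block λs s m →
  s ≤ i → i < s + m → s ≤ blockwise c λs i × blockwise c λs i < s + m
blockwise-within c c-< {λs} {s} {m} {i} b s≤i i<s+m =
  subst (λ k → s ≤ k × k < s + m) (sym c[i]) (m≤m+n s _ , +-monoʳ-< s (c-< j<m))
  where
  j : ℕ
  j = i ∸ s
  i≡s+j : i ≡ s + j
  i≡s+j = sym (m+[n∸m]≡n s≤i)
  j<m : j < m
  j<m = +-cancelˡ-< s j m (subst (_< s + m) i≡s+j i<s+m)
  c[i] : blockwise c λs i ≡ s + c m j
  c[i] = trans (cong (blockwise c λs) i≡s+j) (blockwise-block c b j<m)

module ModelComponents (λs : List ℕ) (pos : All (1 ≤_) λs)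
                       {f : Pt (sum λs) → Pt (sum λs)} (f≈ : Represents f (model λs)) where

  private
    N : ℕ
    N = sum λs

    ix : Pt N → ℕ
    ix = toℕ ∘ proj₁

    ix-f : ∀ y → ix (f y) ≡ proj₁ (model λs ⟦ y ⟧)
    ix-f y = cong proj₁ (f≈ y)

    f-inv : Involutive _≡_ f
    f-inv = proj₁ (represents-FPFInv f≈ (model-involutive λs) (model-fixedPointFree λs))

  InBlock : ℕ → ℕ → Pt N → Set
  InBlock s m y = s ≤ ix y × ix y < s + m

  f-preserves-InBlock : ∀ {s m} → Block λs s m → ∀ {y} → InBlock s m y → InBlock s m (f y)
  f-preserves-InBlock b {i , true}  (s≤i , i<s+m) =
    subst (λ k → _ ≤ k × k < _) (sym (ix-f (i , true)))  (blockwise-within cycle-next cycle-next-< b s≤i i<s+m)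
  f-preserves-InBlock b {i , false} (s≤i , i<s+m) =
    subst (λ k → _ ≤ k × k < _) (sym (ix-f (i , false))) (blockwise-within cycle-prev cycle-prev-< b s≤i i<s+m)

  Conn-InBlock : ∀ {s m} → Block λs s m → ∀ {r y} → InBlock s m r → Conn f r y → InBlock s m y
  Conn-InBlock b r∈ here                          = r∈
  Conn-InBlock b r∈ (step {y = i , true}  (here refl) c) = Conn-InBlock b r∈ c
  Conn-InBlock b r∈ (step {y = i , false} (here refl) c) = Conn-InBlock b r∈ c
  Conn-InBlock b r∈ (step (there (here refl)) c) = f-preserves-InBlock b (Conn-InBlock b r∈ c)

  module _ {s m} (b : Block λs s m) {r : Pt N} (⟦r⟧ : ⟦ r ⟧ ≡ (s , false)) where

    private
      reach-unbarred : ∀ j → j < m → ∀ i → toℕ i ≡ s + j → Conn f r (i , false)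
      reach : ∀ j → j < m → ∀ y → ix y ≡ s + j → Conn f r y

      reach j j<m (i , true)  i≡s+j = step (here refl) (reach-unbarred j j<m i i≡s+j)
      reach j j<m (i , false) i≡s+j = reach-unbarred j j<m i i≡s+j

      reach-unbarred zero    _   i i≡s+0 =
        subst (Conn f r) (⟦⟧-injective (trans ⟦r⟧ (cong (_, false) (sym (trans i≡s+0 (+-identityʳ s)))))) here
      reach-unbarred (suc j) j<m i i≡s+1+j =
        subst (Conn f r) (f-inv (i , false))
          (step (there (here refl)) (reach j (<-trans (n<1+n j) j<m) (f (i , false)) ix-f[i]))
        where
        ix-f[i] : ix (f (i , false)) ≡ s + j
        ix-f[i] = trans (ix-f (i , false)) (trans (cong (prev λs) i≡s+1+j) (blockwise-block cycle-prev b j<m))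

    InBlock-reachable : ∀ {y} → InBlock s m y → Conn f r y
    InBlock-reachable {y} (s≤y , y<s+m) =
      reach (ix y ∸ s) (+-cancelˡ-< s _ m (subst (_< s + m) (sym (m+[n∸m]≡n s≤y)) y<s+m)) y (sym (m+[n∸m]≡n s≤y))

  private
    first< : ∀ {s m} → s + suc m ≤ N → s < N
    first< {s} s+1+m≤N = <-≤-trans (m<m+n s (s≤s z≤n)) s+1+m≤N

    rest≤ : ∀ {s m} → s + suc m ≤ N → suc s + m ≤ N
    rest≤ {s} {m} = subst (_≤ N) (+-suc s m)

  blockPoints : ∀ s m → s + m ≤ N → List (Pt N)
  blockPoints s zero    _ = []
  blockPoints s (suc m) h = (fromℕ< (first< h) , false) ∷ (fromℕ< (first< h) , true) ∷ blockPoints (suc s) m (rest≤ h)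

  length-blockPoints : ∀ s m h → length (blockPoints s m h) ≡ 2 * m
  length-blockPoints s zero    _ = refl
  length-blockPoints s (suc m) _ = trans (cong (2 +_) (length-blockPoints (suc s) m _)) (sym (*-suc 2 m))

  blockPoints-sound : ∀ s m h {y} → y ∈ blockPoints s m h → InBlock s m y
  blockPoints-sound s (suc m) _ (here refl) =
    ≤-reflexive (sym (toℕ-fromℕ< _)) , subst (_< s + suc m) (sym (toℕ-fromℕ< _)) (m<m+n s (s≤s z≤n))
  blockPoints-sound s (suc m) _ (there (here refl)) =
    ≤-reflexive (sym (toℕ-fromℕ< _)) , subst (_< s + suc m) (sym (toℕ-fromℕ< _)) (m<m+n s (s≤s z≤n))
  blockPoints-sound s (suc m) _ {y} (there (there y∈)) =
    let 1+s≤y , y<1+s+m = blockPoints-sound (suc s) m _ y∈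
    in ≤-trans (n≤1+n s) 1+s≤y , subst (ix y <_) (sym (+-suc s m)) y<1+s+m

  blockPoints-complete : ∀ s m h {y} → InBlock s m y → y ∈ blockPoints s m h
  blockPoints-complete s zero    _ {i , _} (s≤i , i<s+0) =
    ⊥-elim (≤⇒≯ s≤i (subst (toℕ i <_) (+-identityʳ s) i<s+0))
  blockPoints-complete s (suc m) _ {i , b} (s≤i , i<s+1+m) with m≤n⇒m<n∨m≡n s≤i
  ... | inj₁ s<i  = there (there (blockPoints-complete (suc s) m _ (s<i , subst (toℕ i <_) (+-suc s m) i<s+1+m)))
  ... | inj₂ s≡i  = first-two b
    where
    i≡s : i ≡ fromℕ< _
    i≡s = toℕ-injective (trans (sym s≡i) (sym (toℕ-fromℕ< _)))
    first-two : ∀ b → (i , b) ∈ blockPoints s (suc m) _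
    first-two false = here (cong (_, false) i≡s)
    first-two true  = there (here (cong (_, true) i≡s))

  blockPoints-unique : ∀ s m h → Unique (blockPoints s m h)
  blockPoints-unique s zero    _ = []
  blockPoints-unique s (suc m) h =
    ((λ ()) ∷ All.tabulate (below-rest false)) ∷ All.tabulate (below-rest true) ∷ blockPoints-unique (suc s) m _
    where
    below-rest : ∀ b {y} → y ∈ blockPoints (suc s) m (rest≤ h) → (fromℕ< (first< h) , b) ≢ y
    below-rest b y∈ refl = <-irrefl (sym (toℕ-fromℕ< _)) (proj₁ (blockPoints-sound (suc s) m _ y∈))

  block-ComponentSize : ∀ {s m} → Block λs s m → 1 ≤ m → ∀ {r} → ⟦ r ⟧ ≡ (s , false) → ComponentSize f r (2 * m)
  block-ComponentSize {s} {m} b 1≤m {r} ⟦r⟧ =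
    blockPoints s m (block-bound b) , blockPoints-unique s m _ ,
    (λ y → mk⇔ (InBlock-reachable b ⟦r⟧ ∘ blockPoints-sound s m _) (blockPoints-complete s m _ ∘ Conn-InBlock b r∈)) ,
    length-blockPoints s m _
    where
    r∈ : InBlock s m r
    r∈ = subst (λ k → s ≤ k × k < s + m) (sym (cong proj₁ ⟦r⟧)) (≤-refl , m<m+n s 1≤m)

  private
    start : ∃₂ (Block λs) → Pt N
    start (s , m , b) = fromℕ< (<-≤-trans (m<m+n s (block-positive pos b)) (block-bound b)) , false

    ⟦start⟧ : ∀ B → ⟦ start B ⟧ ≡ (proj₁ B , false)
    ⟦start⟧ B = cong (_, false) (toℕ-fromℕ< _)

    start-InBlock : ∀ (B : ∃₂ (Block λs)) → let s , m , _ = B in InBlock s m (start B)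
    start-InBlock B@(s , m , b) = subst (λ k → s ≤ k × k < s + m) (sym (cong proj₁ (⟦start⟧ B)))
                                        (≤-refl , m<m+n s (block-positive pos b))

  hasType : HasType f λs
  hasType = represents-FPFInv f≈ (model-involutive λs) (model-fixedPointFree λs) ,
            starts , λs , covered , separated , sized , ↭-refl
    where
    starts : List (Pt N)
    starts = map start (blocks λs)

    covered : ∀ x → Any (λ r → Conn f r x) starts
    covered x = Any.map⁺ (Any.map (λ {(s , m , b)} → InBlock-reachable b (⟦start⟧ (s , m , b)))
                                  (blocks-cover λs (toℕ<n (proj₁ x))))

    separated : AllPairs (λ r r′ → ¬ Conn f r r′) starts
    separated = AllPairs.map⁺ (AllPairs.map (λ {(s , m , b)} s+m≤s′ c →
      ≤⇒≯ s+m≤s′ (subst (_< s + m) (toℕ-fromℕ< _) (proj₂ (Conn-InBlock b (start-InBlock (s , m , b)) c))))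
      (blocks-ordered λs))

    sized : Pointwise (λ r c → ComponentSize f r (2 * c)) starts λs
    sized = subst (Pointwise _ starts) (blocks-sizes λs) (Pointwise.map⁺ start (proj₁ ∘ proj₂)
      (Pointwise.refl λ {(s , m , b)} → block-ComponentSize b (block-positive pos b) (⟦start⟧ (s , m , b))))

model-HasType : ∀ {n} λs → sum λs ≡ n → All (1 ≤_) λs → ∀ {f : Pt n → Pt n} → Represents f (model λs) → HasType f λs
model-HasType λs refl pos f≈ = ModelComponents.hasType λs pos f≈

-- The upper bound

-- Stated for m + 0 ≡ N because ModelComponents (m ∷ []) lives on Pt (sum (m ∷ [])) = Pt (m + 0).
single-block-connected : ∀ {m N} → m + 0 ≡ N → 1 ≤ m → ∀ {f : Pt N → Pt N} → Represents f (model (m ∷ [])) →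
  ∀ x y → Conn f x y
single-block-connected {m} refl 1≤m {f} f≈ x y =
  orbit-trans (Conn-sym f-inv (from-start x)) (from-start y)
  where
  open ModelComponents (m ∷ []) (1≤m ∷ []) f≈
  f-inv : Involutive _≡_ f
  f-inv = proj₁ (represents-FPFInv f≈ (model-involutive (m ∷ [])) (model-fixedPointFree (m ∷ [])))
  start : Pt (m + 0)
  start = fromℕ< (subst (0 <_) (sym (+-identityʳ m)) 1≤m) , false
  from-start : ∀ z → Conn f start z
  from-start z = InBlock-reachable first (cong (_, false) (toℕ-fromℕ< _))
                   (z≤n , subst (toℕ (proj₁ z) <_) (+-identityʳ m) (toℕ<n (proj₁ z)))

act-reachable : ∀ {n G} σs (ρ : Pt n → Pt n) → (∀ y → Orbit G y (ρ y)) → All (λ σ → transpFun σ ∈ G) σs →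
  ∀ y → Orbit G y (act σs ρ y)
act-reachable []       ρ ρ-edge _          = ρ-edge
act-reachable {G = G} (σ ∷ σs) ρ ρ-edge (σ∈G ∷ σs∈G) = act-reachable σs (conj σ ρ) conj-step σs∈G
  where
  conj-step : ∀ y → Orbit G y (conj σ ρ y)
  conj-step y = orbit-trans (orbit-edge y σ∈G) (orbit-trans (ρ-edge _) (orbit-edge _ σ∈G))

Conn-act⊆GroupOrbit : ∀ {n} σs τs (ρ : Pt n → Pt n) {x y} → Conn (act σs ρ) x y → GroupOrbit (σs ++ τs) ρ x y
Conn-act⊆GroupOrbit σs τs ρ = orbit-mono gen
  where
  gen : ∀ {f} → f ∈ τ ∷ act σs ρ ∷ [] → ∀ y → GroupOrbit (σs ++ τs) ρ y (f y)
  gen (here refl)         y = orbit-edge y (here refl)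
  gen (there (here refl)) y = act-reachable σs ρ (λ z → orbit-edge z (there (here refl)))
    (All.tabulate λ σ∈σs → there (there (∈-map⁺ transpFun (∈-++⁺ˡ σ∈σs)))) y

HasType-cong : ∀ {n} {f g : Pt n → Pt n} {λs} → f ≗ g → HasType f λs → HasType g λs
HasType-cong {f = f} {g} f≗g ((f-inv , f-fpf) , R , sizes , covers , separated , sized , sizes↭λs) =
  ((λ x → trans (cong g (sym (f≗g x))) (trans (sym (f≗g (f x))) (f-inv x))) ,
   (λ x gx≡x → f-fpf x (trans (f≗g x) gx≡x))) ,
  R , sizes ,
  (λ x → Any.map (Conn-cong f≗g) (covers x)) ,
  AllPairs.map (λ ¬c c → ¬c (Conn-cong (sym ∘ f≗g) c)) separated ,
  Pointwise.map (λ (L , L! , L⇔ , len) →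
    L , L! , (λ y → mk⇔ (Conn-cong f≗g ∘ Equivalence.to (L⇔ y)) (Equivalence.from (L⇔ y) ∘ Conn-cong (sym ∘ f≗g))) ,
    len) sized ,
  sizes↭λs

upper-bound : ∀ {n} → 1 ≤ n → ∀ {μ ν} → IsPartition n μ → IsPartition n ν →
  TransTwistedFact n (length μ + length ν ∸ 2) μ ν
upper-bound 1≤n {[]}    (_ , _ , refl) _ = ⊥-elim (<-irrefl refl 1≤n)
upper-bound 1≤n {_ ∷ _} {[]} _ (_ , _ , refl) = ⊥-elim (<-irrefl refl 1≤n)
upper-bound {n} 1≤n {a ∷ μ} {b ∷ ν} (1≤a ∷ μ-pos , _ , eμ) (1≤b ∷ ν-pos , _ , eν) =
  ρν , σs , length-σs ,
  model-HasType (b ∷ ν) eν (1≤b ∷ ν-pos) ρν≈ ,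
  HasType-cong (λ x → sym (act-σs x)) (model-HasType (a ∷ μ) eμ (1≤a ∷ μ-pos) ρμ≈) ,
  λ x y → Conn-act⊆GroupOrbit msν (reverse msμ) ρν (single-block-connected (+-identityʳ n) 1≤n merged≈ x y)
  where
  ρμ ρν : Pt n → Pt n
  ρμ = canonical (a ∷ μ) eμ
  ρν = canonical (b ∷ ν) eν

  ρμ≈ : Represents ρμ (model (a ∷ μ))
  ρμ≈ = canonical-represents (a ∷ μ) eμ
  ρν≈ : Represents ρν (model (b ∷ ν))
  ρν≈ = canonical-represents (b ∷ ν) eν

  msμ msν σs : List (Transp n)
  msμ = mergers 1≤n a μ 1≤a μ-pos eμ
  msν = mergers 1≤n b ν 1≤b ν-pos eν
  σs = msν ++ reverse msμ

  merged≈ : Represents (act msν ρν) (model (n ∷ []))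
  merged≈ = mergers-represents 1≤n b ν 1≤b ν-pos eν ρν≈

  length-σs : length σs ≡ length (a ∷ μ) + length (b ∷ ν) ∸ 2
  length-σs = begin
    length (msν ++ reverse msμ)          ≡⟨ length-++ msν ⟩
    length msν + length (reverse msμ)    ≡⟨ cong₂ _+_ (length-mergers 1≤n b ν 1≤b ν-pos eν)
                                                    (trans (length-reverse msμ) (length-mergers 1≤n a μ 1≤a μ-pos eμ)) ⟩
    length ν + length μ                  ≡⟨ +-comm (length ν) (length μ) ⟩
    length μ + length ν                  ≡⟨ cong (_∸ 1) (+-suc (length μ) (length ν)) ⟨
    length (a ∷ μ) + length (b ∷ ν) ∸ 2  ∎
    where open ≡-Reasoning

  act-σs : act σs ρν ≗ ρμ
  act-σs x = begin
    act (msν ++ reverse msμ) ρν x      ≡⟨ cong (λ f → f x) (act-++ msν (reverse msμ) ρν) ⟩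
    act (reverse msμ) (act msν ρν) x   ≡⟨ act-cong (reverse msμ) (represents-unique {F = model (n ∷ [])} merged≈
                                            (mergers-represents 1≤n a μ 1≤a μ-pos eμ ρμ≈)) x ⟩
    act (reverse msμ) (act msμ ρμ) x   ≡⟨ act-reverse msμ ρμ x ⟩
    ρμ x                               ∎
    where open ≡-Reasoning

proposition4p2 : (n : ℕ) → 1 ≤ n → (μ ν : List ℕ) → IsPartition n μ → IsPartition n ν →
    IsLeast (λ k → TransTwistedFact n k μ ν) (length μ + length ν ∸ 2)
proposition4p2 n 1≤n μ ν μ⊢n ν⊢n = upper-bound 1≤n μ⊢n ν⊢n , λ k → lower-bound 1≤n
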